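{- Let $(s(n))_{n\geq 1}$ be the integer sequence defined by $s(1)=0$, $s(2)=1$, $s(3)=1$ and, for all $k\geq 1$, \[ s(4k) = 2s(2k) - s(k),\quad s(4k+1) = 2s(2k) + s(2k+1),\quad s(4k+2) = 2s(2k+1) + s(2k),\quad s(4k+3) = 2s(2k+1) - s(k). \] Let $(F_n)_{n\geq1}$ be the Fibonacci sequence with $F_1=0$, $F_2=1$, $F_{n+1}=F_n+F_{n-1}$. Then for every integer $n\geq 1$, \[ \max_{2^n\leq t<2^{n+1}} s(t) = F_{2n+1}. \]
   Context: The values $s(t)$ for $2^n\le t<2^{n+1}$ form "row $n$" of the paper's second component tree. -}

module Defs where

open import Data.Nat using (ℕ; zero; suc; _≤_) renaming (_*_ to _⊛_; _+_ to _⊕_)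
open import Data.Integer using (ℤ; +_; _+_; _*_; _-_)
open import Relation.Binary.PropositionalEquality using (_≡_)
open import Data.Product using (_×_)

-- Fibonacci with the paper's indexing: F 1 = 0, F 2 = 1, F (n+1) = F n + F (n-1).
-- F 0 is set to 1 (consistent with F 2 = F 1 + F 0); it is never used.
F : ℕ → ℕ
F zero = 1
F (suc zero) = 0
F (suc (suc n)) = F (suc n) ⊕ F n

-- s : ℕ → ℤ satisfies the paper's defining equations on arguments ≥ 1
-- (the value at 0 is irrelevant).  These equations determine s uniquely on n ≥ 1.
IsS : (ℕ → ℤ) → Set
IsS s =
  (s 1 ≡ + 0) × (s 2 ≡ + 1) × (s 3 ≡ + 1) ×
  (∀ k → 1 ≤ k →
      (s (4 ⊛ k)     ≡ + 2 * s (2 ⊛ k) - s k) ×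
      (s (4 ⊛ k ⊕ 1) ≡ + 2 * s (2 ⊛ k) + s (2 ⊛ k ⊕ 1)) ×
      (s (4 ⊛ k ⊕ 2) ≡ + 2 * s (2 ⊛ k ⊕ 1) + s (2 ⊛ k)) ×
      (s (4 ⊛ k ⊕ 3) ≡ + 2 * s (2 ⊛ k ⊕ 1) - s k))

-- Record at a node k of the tree the value v = s(k) and the gains p = s(2k) − v,
-- q = s(2k+1) − v.  By the recurrence the left child 2k has value s(2k) and gains
-- p, s(2k) + s(2k+1); the right child is the mirror image.  Hence gains stay
-- nonnegative, and on row m the value, the gains, the children and the sum of
-- the children are bounded by F(2m+1), F(2m+2), F(2m+3) and F(2m+4).  All
-- bounds are attained along the zigzag path 1, 3, 6, 13, 26, …, whose nodes carry
-- (F(2m+1), F(2m), F(2m+2)) up to swapping the gains.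
module Submission where

open import Defs
open import Data.Nat using (ℕ; _≤_; _<_; _^_) renaming (_*_ to _⊛_; _+_ to _⊕_)
open import Data.Integer using (ℤ; +_) renaming (_≤_ to _≤ℤ_)
open import Data.Product using (_×_; ∃-syntax)
open import Relation.Binary.PropositionalEquality using (_≡_)

open import Data.Nat using (zero; suc; z≤n; s≤s)
open import Data.Nat.Properties
  using (≤-refl; ≤-trans; ≤-reflexive; ≤-<-trans; +-comm; +-assoc; +-mono-≤;
         m≤m+n; m≤n+m; ≤-pred; m^n>0; *-monoʳ-≤; *-cancelˡ-≤; *-cancelˡ-<)
open import Data.Integer using (_+_; _*_; _-_; +≤+)
open import Data.Product using (_,_; proj₁; proj₂)
open import Data.Sum using (_⊎_; inj₁; inj₂)
open import Relation.Binary.PropositionalEquality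
  using (refl; sym; trans; cong; subst)
import Data.Integer.Tactic.RingSolver as ℤ-Solver
import Data.Nat.Tactic.RingSolver as ℕ-Solver

-- Fibonacci indices are kept in successor form, so that F (3 ⊕ double m) unfolds.
double : ℕ → ℕ
double zero    = zero
double (suc n) = suc (suc (double n))

2*n+1≡1+double : ∀ n → 2 ⊛ n ⊕ 1 ≡ suc (double n)
2*n+1≡1+double zero    = refl
2*n+1≡1+double (suc n) = trans (shift n) (cong (λ m → suc (suc m)) (2*n+1≡1+double n))
  where
  shift : ∀ n → 2 ⊛ suc n ⊕ 1 ≡ 2 ⊕ (2 ⊛ n ⊕ 1)
  shift = ℕ-Solver.solve-∀

1+[2j+1]≡2[1+j] : ∀ j → suc (2 ⊛ j ⊕ 1) ≡ 2 ⊛ suc j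
1+[2j+1]≡2[1+j] = ℕ-Solver.solve-∀

even-or-odd : ∀ k → ∃[ j ] (k ≡ 2 ⊛ j ⊎ k ≡ 2 ⊛ j ⊕ 1)
even-or-odd zero = 0 , inj₁ refl
even-or-odd (suc k) with even-or-odd k
... | j , inj₁ refl = j , inj₂ (+-comm 1 (2 ⊛ j))
... | j , inj₂ refl = suc j , inj₁ (1+[2j+1]≡2[1+j] j)

record InRow (m k : ℕ) : Set where
  constructor inRow
  field
    lower : 2 ^ m ≤ k
    upper : k < 2 ^ (m ⊕ 1)

InRow⇒1≤ : ∀ {m k} → InRow m k → 1 ≤ k
InRow⇒1≤ {m} (inRow lo _) = ≤-trans (m^n>0 2 m) lo

InRow-children : ∀ {m j} → InRow m j → InRow (suc m) (2 ⊛ j) × InRow (suc m) (2 ⊛ j ⊕ 1)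
InRow-children {m} {j} (inRow lo hi) =
  inRow (*-monoʳ-≤ 2 lo) (≤-<-trans (m≤m+n (2 ⊛ j) 1) 2j+1<) ,
  inRow (≤-trans (*-monoʳ-≤ 2 lo) (m≤m+n (2 ⊛ j) 1)) 2j+1<
  where
  2j+1< : 2 ⊛ j ⊕ 1 < 2 ^ (suc m ⊕ 1)
  2j+1< = subst (_≤ 2 ^ (suc m ⊕ 1)) (sym (1+[2j+1]≡2[1+j] j)) (*-monoʳ-≤ 2 hi)

InRow-parent-even : ∀ {m j} → InRow (suc m) (2 ⊛ j) → InRow m j
InRow-parent-even {m} {j} (inRow lo hi) = inRow (*-cancelˡ-≤ 2 lo) (*-cancelˡ-< 2 j (2 ^ (m ⊕ 1)) hi)

InRow-parent-odd : ∀ {m j} → InRow (suc m) (2 ⊛ j ⊕ 1) → InRow m j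
InRow-parent-odd {m} {j} (inRow lo hi) = inRow
  (≤-pred (*-cancelˡ-< 2 (2 ^ m) (suc j) (≤-<-trans lo (≤-reflexive (1+[2j+1]≡2[1+j] j)))))
  (*-cancelˡ-< 2 j (2 ^ (m ⊕ 1)) (≤-<-trans (m≤m+n (2 ⊛ j) 1) hi))

row-induction : (P : ℕ → ℕ → Set) → P 0 1 →
                (∀ {m j} → InRow m j → P m j → P (suc m) (2 ⊛ j) × P (suc m) (2 ⊛ j ⊕ 1)) →
                ∀ m k → InRow m k → P m k
row-induction P base step zero (suc zero) _ = base
row-induction P base step zero (suc (suc k)) (inRow _ (s≤s (s≤s ())))
row-induction P base step (suc m) k r with even-or-odd k
... | j , inj₁ refl = proj₁ (step rj (row-induction P base step m j rj))
  where rj = InRow-parent-even r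
... | j , inj₂ refl = proj₂ (step rj (row-induction P base step m j rj))
  where rj = InRow-parent-odd r

record Node : Set where
  constructor ⟨_,_,_⟩
  field
    value gainˡ gainʳ : ℕ

open Node

descendˡ : Node → Node
descendˡ ⟨ v , p , q ⟩ = ⟨ v ⊕ p , p , (v ⊕ p) ⊕ (v ⊕ q) ⟩

descendʳ : Node → Node
descendʳ ⟨ v , p , q ⟩ = ⟨ v ⊕ q , (v ⊕ q) ⊕ (v ⊕ p) , q ⟩

swap : Node → Node
swap ⟨ v , p , q ⟩ = ⟨ v , q , p ⟩

record Bounded (u a b : ℕ) (t : Node) : Set where
  constructor bounded
  open Node t renaming (value to v; gainˡ to p; gainʳ to q)
  field
    value≤    : v ≤ u
    gainˡ≤    : p ≤ a
    gainʳ≤    : q ≤ a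
    childˡ≤   : v ⊕ p ≤ b
    childʳ≤   : v ⊕ q ≤ b
    children≤ : (v ⊕ p) ⊕ (v ⊕ q) ≤ b ⊕ a

Bounded-swap : ∀ {u a b t} → Bounded u a b t → Bounded u a b (swap t)
Bounded-swap {u} {a} {b} {⟨ v , p , q ⟩} (bounded v≤ p≤ q≤ vp≤ vq≤ sum≤) =
  bounded v≤ q≤ p≤ vq≤ vp≤ (subst (_≤ b ⊕ a) (+-comm (v ⊕ p) (v ⊕ q)) sum≤)

Bounded-descendˡ : ∀ {u a b t} → Bounded u a b t → Bounded b (b ⊕ a) ((b ⊕ a) ⊕ b) (descendˡ t)
Bounded-descendˡ {u} {a} {b} {⟨ v , p , q ⟩} (bounded _ p≤ _ vp≤ _ sum≤) =
  bounded vp≤ (≤-trans p≤ (m≤n+m a b)) sum≤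
          (≤-trans vpp≤ (m≤m+n (b ⊕ a) b))
          (≤-trans vp+sum≤ (≤-reflexive (+-comm b (b ⊕ a))))
          (≤-trans (+-mono-≤ vpp≤ vp+sum≤) (≤-reflexive (sym (+-assoc (b ⊕ a) b (b ⊕ a)))))
  where
  vpp≤ : (v ⊕ p) ⊕ p ≤ b ⊕ a
  vpp≤ = +-mono-≤ vp≤ p≤
  vp+sum≤ : (v ⊕ p) ⊕ ((v ⊕ p) ⊕ (v ⊕ q)) ≤ b ⊕ (b ⊕ a)
  vp+sum≤ = +-mono-≤ vp≤ sum≤

Bounded-descendʳ : ∀ {u a b t} → Bounded u a b t → Bounded b (b ⊕ a) ((b ⊕ a) ⊕ b) (descendʳ t)
Bounded-descendʳ h = Bounded-swap (Bounded-descendˡ (Bounded-swap h))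

RowBounded : ℕ → Node → Set
RowBounded m = Bounded (F (1 ⊕ double m)) (F (2 ⊕ double m)) (F (3 ⊕ double m))

fib-node : ℕ → Node
fib-node m = ⟨ F (1 ⊕ double m) , F (double m) , F (2 ⊕ double m) ⟩

fib-node-descend : ∀ m → descendˡ (swap (fib-node m)) ≡ fib-node (suc m)
fib-node-descend m = cong (λ w → ⟨ w , F (2 ⊕ double m) , w ⊕ F (2 ⊕ double m) ⟩)
                          (+-comm (F (1 ⊕ double m)) (F (2 ⊕ double m)))

2[2k]≡4k : ∀ k → 2 ⊛ (2 ⊛ k) ≡ 4 ⊛ k
2[2k]≡4k = ℕ-Solver.solve-∀
2[2k]+1≡4k+1 : ∀ k → 2 ⊛ (2 ⊛ k) ⊕ 1 ≡ 4 ⊛ k ⊕ 1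
2[2k]+1≡4k+1 = ℕ-Solver.solve-∀
2[2k+1]≡4k+2 : ∀ k → 2 ⊛ (2 ⊛ k ⊕ 1) ≡ 4 ⊛ k ⊕ 2
2[2k+1]≡4k+2 = ℕ-Solver.solve-∀
2[2k+1]+1≡4k+3 : ∀ k → 2 ⊛ (2 ⊛ k ⊕ 1) ⊕ 1 ≡ 4 ⊛ k ⊕ 3
2[2k+1]+1≡4k+3 = ℕ-Solver.solve-∀

2*[a+b]-a≡a+b+b : ∀ (a b : ℤ) → + 2 * (a + b) - a ≡ a + b + b
2*[a+b]-a≡a+b+b = ℤ-Solver.solve-∀

2*a+b≡a+[a+b] : ∀ (a b : ℤ) → + 2 * a + b ≡ a + (a + b)
2*a+b≡a+[a+b] = ℤ-Solver.solve-∀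

module _ {s : ℕ → ℤ} (isS : IsS s) where

  s-grandchildren : ∀ k → 1 ≤ k →
    (s (2 ⊛ (2 ⊛ k))         ≡ + 2 * s (2 ⊛ k)     - s k) ×
    (s (2 ⊛ (2 ⊛ k) ⊕ 1)     ≡ + 2 * s (2 ⊛ k)     + s (2 ⊛ k ⊕ 1)) ×
    (s (2 ⊛ (2 ⊛ k ⊕ 1))     ≡ + 2 * s (2 ⊛ k ⊕ 1) + s (2 ⊛ k)) ×
    (s (2 ⊛ (2 ⊛ k ⊕ 1) ⊕ 1) ≡ + 2 * s (2 ⊛ k ⊕ 1) - s k)
  s-grandchildren k 1≤k with proj₂ (proj₂ (proj₂ isS)) k 1≤k
  ... | s4k , s4k+1 , s4k+2 , s4k+3 =
    trans (cong s (2[2k]≡4k k)) s4k , trans (cong s (2[2k]+1≡4k+1 k)) s4k+1 ,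
    trans (cong s (2[2k+1]≡4k+2 k)) s4k+2 , trans (cong s (2[2k+1]+1≡4k+3 k)) s4k+3

  Describes : ℕ → Node → Set
  Describes k t =
    (s k ≡ + value t) × (s (2 ⊛ k) ≡ + (value t ⊕ gainˡ t)) × (s (2 ⊛ k ⊕ 1) ≡ + (value t ⊕ gainʳ t))

  Describes-root : Describes 1 (fib-node 0)
  Describes-root = proj₁ isS , proj₁ (proj₂ isS) , proj₁ (proj₂ (proj₂ isS))

  Describes-children : ∀ {k t} → 1 ≤ k → Describes k t →
                       Describes (2 ⊛ k) (descendˡ t) × Describes (2 ⊛ k ⊕ 1) (descendʳ t)
  Describes-children {k} {⟨ v , p , q ⟩} 1≤k (sk , s2k , s2k+1)
    with s-grandchildren k 1≤k
  ... | s4k , s4k+1 , s4k+2 , s4k+3 =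
    (s2k , ll , lr) , (s2k+1 , rl , rr)
    where
    ll : s (2 ⊛ (2 ⊛ k)) ≡ + ((v ⊕ p) ⊕ p)
    ll rewrite s4k | s2k | sk = 2*[a+b]-a≡a+b+b (+ v) (+ p)
    lr : s (2 ⊛ (2 ⊛ k) ⊕ 1) ≡ + ((v ⊕ p) ⊕ ((v ⊕ p) ⊕ (v ⊕ q)))
    lr rewrite s4k+1 | s2k | s2k+1 = 2*a+b≡a+[a+b] (+ (v ⊕ p)) (+ (v ⊕ q))
    rl : s (2 ⊛ (2 ⊛ k ⊕ 1)) ≡ + ((v ⊕ q) ⊕ ((v ⊕ q) ⊕ (v ⊕ p)))
    rl rewrite s4k+2 | s2k | s2k+1 = 2*a+b≡a+[a+b] (+ (v ⊕ q)) (+ (v ⊕ p))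
    rr : s (2 ⊛ (2 ⊛ k ⊕ 1) ⊕ 1) ≡ + ((v ⊕ q) ⊕ q)
    rr rewrite s4k+3 | s2k+1 | sk = 2*[a+b]-a≡a+b+b (+ v) (+ q)

  row-bounded : ∀ m k → InRow m k → ∃[ t ] Describes k t × RowBounded m t
  row-bounded = row-induction (λ m k → ∃[ t ] Describes k t × RowBounded m t)
    (fib-node 0 , Describes-root , bounded ≤-refl ≤-refl ≤-refl ≤-refl ≤-refl ≤-refl)
    λ { r (t , d , b) → let (dˡ , dʳ) = Describes-children (InRow⇒1≤ r) d in
          (descendˡ t , dˡ , Bounded-descendˡ b) , (descendʳ t , dʳ , Bounded-descendʳ b) }

  row-max-bound : ∀ m k → InRow m k → s k ≤ℤ + F (1 ⊕ double m)
  row-max-bound m k r with row-bounded m k r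
  ... | t , (sk , _) , b = subst (_≤ℤ + F (1 ⊕ double m)) (sym sk) (+≤+ (Bounded.value≤ b))

  fib-path : ∀ m → ∃[ k ] InRow m k × (Describes k (fib-node m) ⊎ Describes k (swap (fib-node m)))
  fib-path zero = 1 , inRow ≤-refl (s≤s (s≤s z≤n)) , inj₁ Describes-root
  fib-path (suc m) with fib-path m
  ... | k , r , inj₁ d =
    2 ⊛ k ⊕ 1 , proj₂ (InRow-children r) ,
    inj₂ (subst (Describes (2 ⊛ k ⊕ 1)) (cong swap (fib-node-descend m))
                (proj₂ (Describes-children (InRow⇒1≤ r) d)))
  ... | k , r , inj₂ d =
    2 ⊛ k , proj₁ (InRow-children r) ,
    inj₁ (subst (Describes (2 ⊛ k)) (fib-node-descend m)
                (proj₁ (Describes-children (InRow⇒1≤ r) d)))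

  row-max-attained : ∀ m → ∃[ k ] InRow m k × (s k ≡ + F (1 ⊕ double m))
  row-max-attained m with fib-path m
  ... | k , r , inj₁ (sk , _) = k , r , sk
  ... | k , r , inj₂ (sk , _) = k , r , sk

corollary11 : (s : ℕ → ℤ) → IsS s → (n : ℕ) → 1 ≤ n →
    ((t : ℕ) → 2 ^ n ≤ t → t < 2 ^ (n ⊕ 1) → s t ≤ℤ + F (2 ⊛ n ⊕ 1)) ×
    (∃[ t ] ((2 ^ n ≤ t) × (t < 2 ^ (n ⊕ 1)) × (s t ≡ + F (2 ⊛ n ⊕ 1))))
corollary11 s isS n _ rewrite 2*n+1≡1+double n =
  (λ t lo hi → row-max-bound {s} isS n t (inRow lo hi)) ,
  (let (t , inRow lo hi , st) = row-max-attained {s} isS n in t , lo , hi , st)
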